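{- Let $\varphi\in\mathcal{L}_{CoRGAL}$ and let $x$ be a maximal consistent theory. Then $\varphi\in x$ if and only if $(M^C,x)\models\varphi$, where $M^C$ is the canonical model.
   Context: Fix a finite set $A$ of agents and a countable set $P$ of propositional variables. The language $\mathcal{L}_{CoRGAL}$ is given by $\varphi ::= p \mid \neg\varphi \mid (\varphi\wedge\varphi) \mid K_a\varphi \mid [\varphi]\varphi \mid [G,\varphi]\varphi \mid [\langle G\rangle]\varphi$ with $p\in P$, $a\in A$, $G\subseteq A$; $\langle\varphi\rangle\psi:=\neg[\varphi]\neg\psi$, $\langle G,\chi\rangle\varphi:=\neg[G,\chi]\neg\varphi$. $\mathcal{L}_{EL}$ is the fragment built only from $p,\neg,\wedge,K_a$; for $G\subseteq A$, $\mathcal{L}_{EL}^G$ is the set of formulas $\bigwedge_{i\in G}K_i\varphi_i$ with $\varphi_i\in\mathcal{L}_{EL}$; $\psi_G$ denotes an element of $\mathcal{L}_{EL}^G$, $\chi_{A\setminus G}$ one of $\mathcal{L}_{EL}^{A\setminus G}$. Semantics on epistemic models $M=(W,\sim,V)$ ($W\ne\emptyset$, $\sim_a$ equivalence relations, $V:P\to\mathcal{P}(W)$), with $M^\varphi$ the restriction of $M$ to the states satisfying $\varphi$: $p,\neg,\wedge$ as usual; $K_a\varphi$ true at $w$ iff $\varphi$ true at all $v\sim_a w$; $(M,w)\models[\varphi]\psi$ iff $(M,w)\models\varphi$ implies $(M^\varphi,w)\models\psi$; $(M,w)\models[G,\chi]\varphi$ iff $(M,w)\models\chi$ and for all $\psi_G$,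 $(M,w)\models[\psi_G\wedge\chi]\varphi$; $(M,w)\models[\langle G\rangle]\varphi$ iff for all $\psi_G$ there is $\chi_{A\setminus G}$ with $(M,w)\models\psi_G\to\langle\psi_G\wedge\chi_{A\setminus G}\rangle\varphi$. Necessity forms: $\eta ::= \sharp \mid \varphi\to\eta(\sharp) \mid K_a\eta(\sharp) \mid [\varphi]\eta(\sharp)$; $\sharp$ occurs exactly once and $\eta(\varphi)$ is the result of replacing $\sharp$ by $\varphi$. The axiom system $\mathbf{CoRGAL}$ is the smallest set of formulas containing: (A0) propositional tautologies; (A1) $K_a(\varphi\to\psi)\to(K_a\varphi\to K_a\psi)$; (A2) $K_a\varphi\to\varphi$; (A3) $K_a\varphi\to K_aK_a\varphi$; (A4) $\neg K_a\varphi\to K_a\neg K_a\varphi$; (A5) $[\varphi]p\leftrightarrow(\varphi\to p)$; (A6) $[\varphi]\neg\psi\leftrightarrow(\varphi\to\neg[\varphi]\psi)$; (A7) $[\varphi](\psi\wedge\chi)\leftrightarrow([\varphi]\psi\wedge[\varphi]\chi)$; (A8) $[\varphi]K_a\psi\leftrightarrow(\varphi\to K_a[\varphi]\psi)$; (A9) $[\varphi][\psi]\chi\leftrightarrow[\varphi\wedge[\varphi]\psi]\chi$; (A10) $[G,\chi]\varphi\to\chi\wedge[\psi_G\wedge\chi]\varphi$ for any $\psi_G$; (A11) $[\langle G\rangle]\varphi\to\langle A\setminus G,\psi_G\rangle\varphi$ for any $\psi_G$; and closed under: (R0) modus ponens; (R1) from $\varphi$ infer $K_a\varphi$; (R2)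 from $\varphi$ infer $[\psi]\varphi$; (R3) from $\varphi$ infer $[G,\chi]\varphi$; (R4) from $\varphi$ infer $[\langle G\rangle]\varphi$; (R5) if $\eta(\chi\wedge[\psi_G\wedge\chi]\varphi)$ is derivable for all $\psi_G$, infer $\eta([G,\chi]\varphi)$; (R6) if $\eta(\langle A\setminus G,\psi_G\rangle\varphi)$ is derivable for all $\psi_G$, infer $\eta([\langle G\rangle]\varphi)$. A theory is a set of formulas $x$ containing $\mathbf{CoRGAL}$ and closed under R0, R5 (if $\eta(\chi\wedge[\psi_G\wedge\chi]\varphi)\in x$ for all $\psi_G$ then $\eta([G,\chi]\varphi)\in x$) and R6 (if $\eta(\langle A\setminus G,\psi_G\rangle\varphi)\in x$ for all $\psi_G$ then $\eta([\langle G\rangle]\varphi)\in x$); consistent iff $\bot\notin x$; maximal iff for every $\varphi$, $\varphi\in x$ or $\neg\varphi\in x$. The canonical model is $M^C=(W^C,\sim^C,V^C)$ where $W^C$ is the set of all maximal consistent theories, $x\sim^C_a y$ iff $K_ax=K_ay$ with $K_ax=\{\varphi:K_a\varphi\in x\}$, and $x\in V^C(p)$ iff $p\in x$. -}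

open import Data.Nat using (ℕ; zero; suc)

module Defs where

module CoRGAL (n : ℕ) where

  open import Level using (Level; _⊔_; Lift) renaming (suc to lsuc; zero to lzero)
  open import Data.Fin using (Fin; zero; suc)
  open import Data.Fin.Subset using (Subset; ∁)
  open import Data.Vec using (Vec; []; _∷_)
  open import Data.List using (List; []; _∷_; map)
  open import Data.Bool using (Bool; true; false; not; _∧_)
  open import Data.Product using (Σ; _×_; _,_; proj₁; proj₂)
  open import Data.Sum using (_⊎_)
  open import Data.Empty using (⊥)
  open import Relation.Nullary using (¬_)
  open import Relation.Binary.PropositionalEquality using (_≡_)
  open import Relation.Binary.Structures using (IsEquivalence)

  Agent : Set
  Agent = Fin n

  data ELF : Set where
    evar : ℕ → ELF
    eneg : ELF → ELF
    eand : ELF → ELF → ELF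
    eK   : Agent → ELF → ELF

  data Formula : Set where
    var  : ℕ → Formula
    neg  : Formula → Formula
    and  : Formula → Formula → Formula
    K    : Agent → Formula → Formula
    ann  : Formula → Formula → Formula
    grp  : Subset n → Formula → Formula → Formula
    coal : Subset n → Formula → Formula

  embed : ELF → Formula
  embed (evar p)   = var p
  embed (eneg φ)   = neg (embed φ)
  embed (eand φ ψ) = and (embed φ) (embed ψ)
  embed (eK a φ)   = K a (embed φ)

  ⊤EL : ELF
  ⊤EL = eneg (eand (evar 0) (eneg (evar 0)))

  ⊤F : Formula
  ⊤F = embed ⊤EL

  ⊥F : Formula
  ⊥F = neg ⊤F

  _⇒_ : Formula → Formula → Formula
  φ ⇒ ψ = neg (and φ (neg ψ))

  _⇔F_ : Formula → Formula → Formula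
  φ ⇔F ψ = and (φ ⇒ ψ) (ψ ⇒ φ)

  dia : Formula → Formula → Formula
  dia φ ψ = neg (ann φ (neg ψ))

  grpDia : Subset n → Formula → Formula → Formula
  grpDia G χ φ = neg (grp G χ (neg φ))

  members : ∀ {m} → Subset m → List (Fin m)
  members []          = []
  members (true ∷ G)  = zero ∷ map suc (members G)
  members (false ∷ G) = map suc (members G)

  conjEL : List ELF → ELF
  conjEL []           = ⊤EL
  conjEL (φ ∷ [])     = φ
  conjEL (φ ∷ ψ ∷ ψs) = eand φ (conjEL (ψ ∷ ψs))

  -- Elements ψ_G of L_EL^G: ψ_G = ⋀_{i∈G} K_i φ_i, given by a choice
  -- f i = φ_i of an EL formula for every agent (values outside G unused).
  ELG : Set
  ELG = Agent → ELF

  ⟦_⟧_ : ELG → Subset n → ELF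
  ⟦ f ⟧ G = conjEL (map (λ i → eK i (f i)) (members G))

  record Model (ℓw ℓr : Level) : Set (lsuc (ℓw ⊔ ℓr)) where
    field
      W     : Set ℓw
      R     : Agent → W → W → Set ℓr
      equiv : ∀ a → IsEquivalence (R a)
      V     : ℕ → W → Set ℓr

  restrict : ∀ {ℓw ℓr ℓq} (M : Model ℓw ℓr) → (Model.W M → Set ℓq) → Model (ℓw ⊔ ℓq) ℓr
  restrict M Q = record
    { W     = Σ W Q
    ; R     = λ a u v → R a (proj₁ u) (proj₁ v)
    ; equiv = λ a → record
        { refl  = IsEquivalence.refl (equiv a)
        ; sym   = IsEquivalence.sym (equiv a)
        ; trans = IsEquivalence.trans (equiv a) }
    ; V     = λ p u → V p (proj₁ u)
    }
    where open Model M

  satEL : ∀ {ℓw ℓr} (M : Model ℓw ℓr) → Model.W M → ELF → Set (ℓw ⊔ ℓr)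
  satEL {ℓw} M w (evar p)   = Lift ℓw (Model.V M p w)
  satEL M w (eneg φ)        = ¬ satEL M w φ
  satEL M w (eand φ ψ)      = satEL M w φ × satEL M w ψ
  satEL M w (eK a φ)        = ∀ v → Model.R M a w v → satEL M v φ

  -- truth of CoRGAL formulas (the clauses for [G,χ] and [⟨G⟩] are the
  -- given clauses with [ψ_G ∧ χ]φ and ⟨ψ_G ∧ χ⟩φ unfolded)
  _,_⊨_ : ∀ {ℓw ℓr} (M : Model ℓw ℓr) → Model.W M → Formula → Set (ℓw ⊔ ℓr)
  _,_⊨_ {ℓw} M w (var p) = Lift ℓw (Model.V M p w)
  M , w ⊨ neg φ   = ¬ (M , w ⊨ φ)
  M , w ⊨ and φ ψ = (M , w ⊨ φ) × (M , w ⊨ ψ)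
  M , w ⊨ K a φ   = ∀ v → Model.R M a w v → M , v ⊨ φ
  M , w ⊨ ann φ ψ =
    (h : M , w ⊨ φ) → restrict M (λ v → M , v ⊨ φ) , (w , h) ⊨ ψ
  M , w ⊨ grp G χ φ =
    (M , w ⊨ χ) ×
    ((f : ELG) →
       let θ = λ v → satEL M v (⟦ f ⟧ G) × (M , v ⊨ χ) in
       (h : θ w) → restrict M θ , (w , h) ⊨ φ)
  M , w ⊨ coal G φ =
    (f : ELG) → Σ ELG λ g →
       let θ = λ v → satEL M v (⟦ f ⟧ G) × satEL M v (⟦ g ⟧ (∁ G)) in
       -- ψ_G → ⟨ψ_G ∧ χ_{A∖G}⟩φ
       satEL M w (⟦ f ⟧ G) → ¬ ((h : θ w) → ¬ (restrict M θ , (w , h) ⊨ φ))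

  -- propositional tautologies: formulas true under every boolean valuation
  -- of their maximal non-boolean subformulas
  evalB : (Formula → Bool) → Formula → Bool
  evalB v (neg φ)   = not (evalB v φ)
  evalB v (and φ ψ) = evalB v φ ∧ evalB v ψ
  evalB v φ         = v φ

  Tautology : Formula → Set
  Tautology φ = ∀ v → evalB v φ ≡ true

  data NForm : Set where
    ♯    : NForm
    nimp : Formula → NForm → NForm
    nK   : Agent → NForm → NForm
    nann : Formula → NForm → NForm

  plug : NForm → Formula → Formula
  plug ♯ φ          = φ
  plug (nimp ψ η) φ = ψ ⇒ plug η φ
  plug (nK a η) φ   = K a (plug η φ)
  plug (nann ψ η) φ = ann ψ (plug η φ)

  infix 4 ⊢_
  data ⊢_ : Formula → Set where
    A0  : ∀ {φ} → Tautology φ → ⊢ φ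
    A1  : ∀ a φ ψ → ⊢ (K a (φ ⇒ ψ) ⇒ (K a φ ⇒ K a ψ))
    A2  : ∀ a φ → ⊢ (K a φ ⇒ φ)
    A3  : ∀ a φ → ⊢ (K a φ ⇒ K a (K a φ))
    A4  : ∀ a φ → ⊢ (neg (K a φ) ⇒ K a (neg (K a φ)))
    A5  : ∀ φ p → ⊢ (ann φ (var p) ⇔F (φ ⇒ var p))
    A6  : ∀ φ ψ → ⊢ (ann φ (neg ψ) ⇔F (φ ⇒ neg (ann φ ψ)))
    A7  : ∀ φ ψ χ → ⊢ (ann φ (and ψ χ) ⇔F and (ann φ ψ) (ann φ χ))
    A8  : ∀ φ a ψ → ⊢ (ann φ (K a ψ) ⇔F (φ ⇒ K a (ann φ ψ)))
    A9  : ∀ φ ψ χ → ⊢ (ann φ (ann ψ χ) ⇔F ann (and φ (ann φ ψ)) χ)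
    A10 : ∀ G χ φ (f : ELG) →
            ⊢ (grp G χ φ ⇒ and χ (ann (and (embed (⟦ f ⟧ G)) χ) φ))
    A11 : ∀ G φ (f : ELG) →
            ⊢ (coal G φ ⇒ grpDia (∁ G) (embed (⟦ f ⟧ G)) φ)
    R0  : ∀ {φ ψ} → ⊢ (φ ⇒ ψ) → ⊢ φ → ⊢ ψ
    R1  : ∀ {φ} a → ⊢ φ → ⊢ K a φ
    R2  : ∀ {φ} ψ → ⊢ φ → ⊢ ann ψ φ
    R3  : ∀ {φ} G χ → ⊢ φ → ⊢ grp G χ φ
    R4  : ∀ {φ} G → ⊢ φ → ⊢ coal G φ
    R5  : ∀ η G χ φ →
            ((f : ELG) → ⊢ plug η (and χ (ann (and (embed (⟦ f ⟧ G)) χ) φ))) →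
            ⊢ plug η (grp G χ φ)
    R6  : ∀ η G φ →
            ((f : ELG) → ⊢ plug η (grpDia (∁ G) (embed (⟦ f ⟧ G)) φ)) →
            ⊢ plug η (coal G φ)

  record IsTheory (x : Formula → Set) : Set where
    field
      thm : ∀ {φ} → ⊢ φ → x φ
      mp  : ∀ {φ ψ} → x (φ ⇒ ψ) → x φ → x ψ
      r5  : ∀ η G χ φ →
              ((f : ELG) → x (plug η (and χ (ann (and (embed (⟦ f ⟧ G)) χ) φ)))) →
              x (plug η (grp G χ φ))
      r6  : ∀ η G φ →
              ((f : ELG) → x (plug η (grpDia (∁ G) (embed (⟦ f ⟧ G)) φ))) →
              x (plug η (coal G φ))

  Consistent : (Formula → Set) → Set
  Consistent x = ¬ x ⊥F

  Maximal : (Formula → Set) → Set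
  Maximal x = ∀ φ → x φ ⊎ x (neg φ)

  record MCT : Set₁ where
    field
      mem        : Formula → Set
      isTheory   : IsTheory mem
      consistent : Consistent mem
      maximal    : Maximal mem

  open MCT public

  _∼C[_]_ : MCT → Agent → MCT → Set
  x ∼C[ a ] y = ∀ φ → (mem x (K a φ) → mem y (K a φ)) × (mem y (K a φ) → mem x (K a φ))

  canonical : Model (lsuc lzero) lzero
  canonical = record
    { W     = MCT
    ; R     = λ a x y → x ∼C[ a ] y
    ; equiv = λ a → record
        { refl  = λ φ → (λ h → h) , (λ h → h)
        ; sym   = λ e φ → proj₂ (e φ) , proj₁ (e φ)
        ; trans = λ e₁ e₂ φ → (λ h → proj₁ (e₂ φ) (proj₁ (e₁ φ) h))
                            , (λ h → proj₂ (e₁ φ) (proj₂ (e₂ φ) h)) }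
    ; V     = λ p x → mem x (var p)
    }

module Submission where

open import Defs
open import Data.Nat using (ℕ)
open import Level using (0ℓ; suc)
open import Function.Bundles using (_⇔_)
open import Axiom.ExcludedMiddle using (ExcludedMiddle)

-- Induction on formulas, ordered lexicographically by the nesting depth of
-- the quantifying operators [G,χ], [⟨G⟩] and by a size in which
-- announcements count multiplicatively, so that the reduction axioms A5–A9
-- and the premises of R5/R6 all decrease.  Finally, under
-- excluded middle (for Lindenbaum and the ∃ in [⟨G⟩]), each case of the
-- truth lemma pairs a syntactic fact about maximal theories with its
-- semantic counterpart.

open import Data.Nat as Nat using (zero; _<_; _≤_; _⊔_; _+_; _*_; z≤n; s≤s)
open import Data.Nat.Properties
  using (≤-refl; ≤-trans; <-≤-trans; <⇒≤; ≤-reflexive; n≮0; ≤-pred; n<1+n;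
         m≤m+n; m≤n+m; m≤m⊔n; m≤n⊔m; m⊔n≤o⇒m≤o; m⊔n≤o⇒n≤o; ⊔-lub; +-comm; +-assoc;
         +-monoʳ-≤; +-monoˡ-≤; +-monoʳ-<; +-monoˡ-<; *-monoˡ-≤; *-monoʳ-<; *-monoˡ-<;
         *-suc; *-assoc; *-distribˡ-+; m≤m*n)
open import Data.Fin using (Fin) renaming (zero to fzero; suc to fsuc)
open import Data.Fin.Subset using (Subset; ∁)
open import Data.Vec using (Vec; []; _∷_; lookup; map)
open import Data.Vec.Properties using (lookup-map)
open import Data.Bool using (Bool; true; false; not; _∧_; T)
open import Data.Bool.Properties using (T-≡; T-∧)
open import Data.Maybe using (Maybe; just; nothing) renaming (map to mapMaybe)
open import Data.Maybe.Properties using (just-injective)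
open import Data.Product using (Σ; _×_; _,_; proj₁; proj₂; map₁; map₂; uncurry)
open import Data.Product.Function.NonDependent.Propositional using (_×-⇔_)
open import Data.Sum using (_⊎_; inj₁; inj₂)
open import Data.Empty using (⊥; ⊥-elim)
open import Data.List using (List; []; _∷_; _++_; concat; cartesianProductWith; cartesianProduct; upTo; allFin)
open import Data.List.Membership.Propositional using (_∈_)
open import Data.List.Membership.Propositional.Properties
  using (∈-map⁺; ∈-++⁺ˡ; ∈-++⁺ʳ; ∈-concat⁺′; ∈-cartesianProductWith⁺; ∈-cartesianProduct⁺; ∈-upTo⁺; ∈-allFin)
open import Data.List.Relation.Unary.All using (All; []; _∷_) renaming (lookup to All-lookup)
open import Data.List.Relation.Unary.Any using (here; there)
open import Function using (_∘_)
open import Function.Bundles using (Equivalence; mk⇔)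
open import Function.Construct.Identity using (⇔-id)
open import Function.Related.TypeIsomorphisms using (¬-cong-⇔; →-cong-⇔)
open import Function.Related.Propositional using (module EquationalReasoning; equivalence)
open import Relation.Nullary using (¬_; Dec; yes; no)
open import Relation.Nullary.Decidable using (decidable-stable)
open import Relation.Unary using (_⊆_)
open import Relation.Binary.PropositionalEquality using (_≡_; refl; sym; trans; cong; cong₂; subst)
import Level as L

open Equivalence using (to; from)

lift-⇔ : ∀ {a b ℓ ℓ′} {A : Set a} {B : Set b} → A ⇔ B → L.Lift ℓ A ⇔ L.Lift ℓ′ B
lift-⇔ A⇔B = mk⇔ (L.lift ∘ to A⇔B ∘ L.lower) (L.lift ∘ from A⇔B ∘ L.lower)

Π-⇔ : ∀ {i p q} {I : Set i} {P : I → Set p} {Q : I → Set q} →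
      (∀ x → P x ⇔ Q x) → (∀ x → P x) ⇔ (∀ x → Q x)
Π-⇔ P⇔Q = mk⇔ (λ s x → to (P⇔Q x) (s x)) (λ s x → from (P⇔Q x) (s x))

Σ-⇔ : ∀ {i p q} {I : Set i} {P : I → Set p} {Q : I → Set q} →
      (∀ x → P x ⇔ Q x) → Σ I P ⇔ Σ I Q
Σ-⇔ P⇔Q = mk⇔ (λ (x , p) → x , to (P⇔Q x) p) (λ (x , q) → x , from (P⇔Q x) q)

Π-dom-⇔ : ∀ {a b p q} {A : Set a} {B : Set b} {P : A → Set p} {Q : B → Set q} →
          (A⇔B : A ⇔ B) → (∀ x y → P x ⇔ Q y) → ((x : A) → P x) ⇔ ((y : B) → Q y)
Π-dom-⇔ A⇔B P⇔Q = mk⇔ (λ s y → to (P⇔Q _ y) (s (from A⇔B y))) (λ s x → from (P⇔Q x _) (s (to A⇔B x)))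

classical-witness : ∀ {ℓ} → ExcludedMiddle ℓ → {I : Set} {S : Set ℓ} {A : I → Set ℓ} → I →
                    Σ I (λ g → S → ¬ A g) ⇔ (¬ (S × (∀ g → A g)))
classical-witness em {I} {S} {A} g₀ = mk⇔ (λ (g , k) (s , all) → k s (all g)) witness
  where
  witness : ¬ (S × (∀ g → A g)) → Σ I (λ g → S → ¬ A g)
  witness ¬both with em {S}
  ... | no ¬s = g₀ , λ s → ⊥-elim (¬s s)
  ... | yes s with em {Σ I λ g → ¬ A g}
  ...   | yes (g , ¬a) = g , λ _ → ¬a
  ...   | no none = ⊥-elim (¬both (s , λ g → decidable-stable em λ ¬a → none (g , ¬a)))

module LexInduction {a} {A : Set a} (μ ν : A → ℕ) where

  infix 4 _≺_
  _≺_ : A → A → Set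
  x ≺ y = μ x < μ y ⊎ (μ x ≤ μ y × ν x < ν y)

  induction : ∀ {ℓ} (P : A → Set ℓ) → (∀ x → (∀ y → y ≺ x → P y) → P x) → ∀ x → P x
  induction P step x = bounded (μ x) (ν x) x ≤-refl ≤-refl
    where
    bounded : ∀ d c x → μ x ≤ d → ν x ≤ c → P x
    below   : ∀ d c x → μ x ≤ d → ν x ≤ c → ∀ y → y ≺ x → P y
    bounded d c x μ≤ ν≤ = step x (below d c x μ≤ ν≤)
    below zero        c x μ≤ ν≤ y (inj₁ μ<) = ⊥-elim (n≮0 (<-≤-trans μ< μ≤))
    below (Nat.suc d) c x μ≤ ν≤ y (inj₁ μ<) = bounded d (ν y) y (≤-pred (<-≤-trans μ< μ≤)) ≤-refl
    below d zero        x μ≤ ν≤ y (inj₂ (_ , ν<)) = ⊥-elim (n≮0 (<-≤-trans ν< ν≤))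
    below d (Nat.suc c) x μ≤ ν≤ y (inj₂ (μ≤′ , ν<)) = bounded d c y (≤-trans μ≤′ μ≤) (≤-pred (<-≤-trans ν< ν≤))

module _ (n : ℕ) where
  open CoRGAL n

  -- Propositional formulas over k atoms.  Checking all 2^k valuations
  -- certifies a tautology; substituting CoRGAL formulas for the atoms then
  -- yields an instance of axiom A0.
  data Prop (k : ℕ) : Set where
    atom : Fin k → Prop k
    ~_   : Prop k → Prop k
    _&_  : Prop k → Prop k → Prop k

  infix  8 ~_
  infixr 7 _&_
  infixr 6 _⟶_
  infix  5 _⟷_

  _⟶_ _⟷_ : ∀ {k} → Prop k → Prop k → Prop k
  a ⟶ b = ~ (a & ~ b)
  a ⟷ b = (a ⟶ b) & (b ⟶ a)

  -- the propositional shape of ⊥F = ¬¬(p ∧ ¬p)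
  ⊥ₚ : ∀ {k} → Prop k → Prop k
  ⊥ₚ a = ~ ~ (a & ~ a)

  p₀ : ∀ {k} → Prop (1 + k)
  p₀ = atom fzero
  p₁ : ∀ {k} → Prop (2 + k)
  p₁ = atom (fsuc fzero)
  p₂ : ∀ {k} → Prop (3 + k)
  p₂ = atom (fsuc (fsuc fzero))
  p₃ : ∀ {k} → Prop (4 + k)
  p₃ = atom (fsuc (fsuc (fsuc fzero)))
  p₄ : ∀ {k} → Prop (5 + k)
  p₄ = atom (fsuc (fsuc (fsuc (fsuc fzero))))
  p₅ : ∀ {k} → Prop (6 + k)
  p₅ = atom (fsuc (fsuc (fsuc (fsuc (fsuc fzero)))))

  evaluate : ∀ {k} → Vec Bool k → Prop k → Bool
  evaluate v (atom i) = lookup v i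
  evaluate v (~ a)    = not (evaluate v a)
  evaluate v (a & b)  = evaluate v a ∧ evaluate v b

  allValuations : ∀ k → (Vec Bool k → Bool) → Bool
  allValuations zero        f = f []
  allValuations (Nat.suc k) f = allValuations k (f ∘ (true ∷_)) ∧ allValuations k (f ∘ (false ∷_))

  allValuations-sound : ∀ k f → T (allValuations k f) → ∀ v → T (f v)
  allValuations-sound zero        f holds [] = holds
  allValuations-sound (Nat.suc k) f holds (true ∷ v)  =
    allValuations-sound k _ (proj₁ (to T-∧ holds)) v
  allValuations-sound (Nat.suc k) f holds (false ∷ v) =
    allValuations-sound k _ (proj₂ (to T-∧ holds)) v

  substitute : ∀ {k} → Vec Formula k → Prop k → Formula
  substitute σ (atom i) = lookup σ i
  substitute σ (~ a)    = neg (substitute σ a)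
  substitute σ (a & b)  = and (substitute σ a) (substitute σ b)

  evalB-substitute : ∀ {k} val (σ : Vec Formula k) a →
                     evalB val (substitute σ a) ≡ evaluate (map (evalB val) σ) a
  evalB-substitute val σ (atom i) = sym (lookup-map i (evalB val) σ)
  evalB-substitute val σ (~ a)    = cong not (evalB-substitute val σ a)
  evalB-substitute val σ (a & b)  = cong₂ _∧_ (evalB-substitute val σ a) (evalB-substitute val σ b)

  -- every substitution instance of a checked tautology is a theorem; the
  -- check itself is the implicit argument, solved by evaluation
  taut : ∀ {k} (σ : Vec Formula k) (a : Prop k) {_ : T (allValuations k (λ v → evaluate v a))} →
         ⊢ substitute σ a
  taut σ a {valid} = A0 λ val →
    trans (evalB-substitute val σ a)
          (to T-≡ (allValuations-sound _ _ valid (map (evalB val) σ)))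

  K-mono : ∀ i {φ ψ} → ⊢ (φ ⇒ ψ) → ⊢ (K i φ ⇒ K i ψ)
  K-mono i {φ} {ψ} d = R0 (A1 i φ ψ) (R1 i d)

  K-mono₂ : ∀ i {φ ψ χ} → ⊢ (φ ⇒ (ψ ⇒ χ)) → ⊢ (K i φ ⇒ (K i ψ ⇒ K i χ))
  K-mono₂ i {φ} {ψ} {χ} d =
    R0 (R0 (taut (K i φ ∷ K i (ψ ⇒ χ) ∷ K i ψ ∷ K i χ ∷ [])
                 ((p₀ ⟶ p₁) ⟶ (p₁ ⟶ p₂ ⟶ p₃) ⟶ p₀ ⟶ p₂ ⟶ p₃))
           (K-mono i d))
       (A1 i ψ χ)

  -- Cases of ann-vacuous below, stated for arbitrary inductive hypotheses
  -- so that R5 can reuse them on the premises of [G,χ]ψ.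
  vacuous-neg : ∀ ψ φ → ⊢ (neg φ ⇒ ann φ (neg ψ))
  vacuous-neg ψ φ =
    R0 (taut (ann φ (neg ψ) ∷ φ ∷ ann φ ψ ∷ []) ((p₀ ⟷ (p₁ ⟶ ~ p₂)) ⟶ ~ p₁ ⟶ p₀)) (A6 φ ψ)

  vacuous-and : ∀ ψ χ → (∀ φ → ⊢ (neg φ ⇒ ann φ ψ)) → (∀ φ → ⊢ (neg φ ⇒ ann φ χ)) →
                ∀ φ → ⊢ (neg φ ⇒ ann φ (and ψ χ))
  vacuous-and ψ χ vac-ψ vac-χ φ =
    R0 (R0 (R0 (taut (ann φ (and ψ χ) ∷ φ ∷ ann φ ψ ∷ ann φ χ ∷ [])
                     ((p₀ ⟷ p₂ & p₃) ⟶ (~ p₁ ⟶ p₂) ⟶ (~ p₁ ⟶ p₃) ⟶ ~ p₁ ⟶ p₀))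
               (A7 φ ψ χ)) (vac-ψ φ)) (vac-χ φ)

  vacuous-ann : ∀ ψ χ → (∀ φ → ⊢ (neg φ ⇒ ann φ χ)) → ∀ φ → ⊢ (neg φ ⇒ ann φ (ann ψ χ))
  vacuous-ann ψ χ vac-χ φ =
    R0 (R0 (taut (ann φ (ann ψ χ) ∷ ann (and φ (ann φ ψ)) χ ∷ φ ∷ ann φ ψ ∷ [])
                 ((p₀ ⟷ p₁) ⟶ (~ (p₂ & p₃) ⟶ p₁) ⟶ ~ p₂ ⟶ p₀))
           (A9 φ ψ χ)) (vac-χ (and φ (ann φ ψ)))

  -- By
  -- induction on ψ via the reduction axioms; the quantifying operators are
  -- handled by R5/R6 in the necessity form ¬φ → [φ]♯.
  ann-vacuous : ∀ ψ φ → ⊢ (neg φ ⇒ ann φ ψ)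
  ann-vacuous (var p) φ =
    R0 (taut (ann φ (var p) ∷ φ ∷ var p ∷ []) ((p₀ ⟷ (p₁ ⟶ p₂)) ⟶ ~ p₁ ⟶ p₀)) (A5 φ p)
  ann-vacuous (neg ψ) φ = vacuous-neg ψ φ
  ann-vacuous (and ψ χ) φ = vacuous-and ψ χ (ann-vacuous ψ) (ann-vacuous χ) φ
  ann-vacuous (K i ψ) φ =
    R0 (taut (ann φ (K i ψ) ∷ φ ∷ K i (ann φ ψ) ∷ []) ((p₀ ⟷ (p₁ ⟶ p₂)) ⟶ ~ p₁ ⟶ p₀)) (A8 φ i ψ)
  ann-vacuous (ann ψ χ) φ = vacuous-ann ψ χ (ann-vacuous χ) φ
  ann-vacuous (grp G χ ψ) φ = R5 (nimp (neg φ) (nann φ ♯)) G χ ψ λ f →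
    vacuous-and χ _ (ann-vacuous χ) (vacuous-ann (and (embed (⟦ f ⟧ G)) χ) ψ (ann-vacuous ψ)) φ
  ann-vacuous (coal G ψ) φ = R6 (nimp (neg φ) (nann φ ♯)) G ψ λ f → vacuous-neg _ φ

  ann-distrib : ∀ φ ψ χ → ⊢ (ann φ (ψ ⇒ χ) ⇒ (ann φ ψ ⇒ ann φ χ))
  ann-distrib φ ψ χ =
    R0 (R0 (R0 (R0 (taut (φ ∷ ann φ ψ ∷ ann φ χ ∷ ann φ (and ψ (neg χ)) ∷ ann φ (neg χ) ∷ ann φ (ψ ⇒ χ) ∷ [])
                         ((p₅ ⟷ (p₀ ⟶ ~ p₃)) ⟶ (p₃ ⟷ p₁ & p₄) ⟶ (p₄ ⟷ (p₀ ⟶ ~ p₂)) ⟶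
                          (~ p₀ ⟶ p₂) ⟶ p₅ ⟶ p₁ ⟶ p₂))
                   (A6 φ (and ψ (neg χ)))) (A7 φ ψ (neg χ))) (A6 φ χ)) (ann-vacuous χ φ)

  ann-mono : ∀ φ {ψ χ} → ⊢ (ψ ⇒ χ) → ⊢ (ann φ ψ ⇒ ann φ χ)
  ann-mono φ {ψ} {χ} d = R0 (ann-distrib φ ψ χ) (R2 φ d)

  module TheoryReasoning {x : Formula → Set} (T : IsTheory x) where
    open IsTheory T public

    by₁ : ∀ {φ ψ} → ⊢ (φ ⇒ ψ) → x φ → x ψ
    by₁ d = mp (thm d)

    by₂ : ∀ {φ ψ χ} → ⊢ (φ ⇒ (ψ ⇒ χ)) → x φ → x ψ → x χ
    by₂ d h k = mp (mp (thm d) h) k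

    explode : ∀ {φ} → x φ → x (neg φ) → x ⊥F
    explode {φ} = by₂ (taut (φ ∷ var 0 ∷ []) (p₀ ⟶ ~ p₀ ⟶ ⊥ₚ p₁))

  module MCTReasoning (x : MCT) where
    open TheoryReasoning (isTheory x) public

    mem-neg : ∀ {φ} → mem x (neg φ) ⇔ (¬ mem x φ)
    mem-neg {φ} = mk⇔ (λ ¬φ φ → consistent x (explode φ ¬φ)) not-in
      where
      not-in : ¬ mem x φ → mem x (neg φ)
      not-in ∉ with maximal x φ
      ... | inj₁ ∈ = ⊥-elim (∉ ∈)
      ... | inj₂ ¬φ = ¬φ

    mem-and : ∀ {φ ψ} → mem x (and φ ψ) ⇔ (mem x φ × mem x ψ)
    mem-and {φ} {ψ} = mk⇔
      (λ h → by₁ (taut (φ ∷ ψ ∷ []) (p₀ & p₁ ⟶ p₀)) h , by₁ (taut (φ ∷ ψ ∷ []) (p₀ & p₁ ⟶ p₁)) h)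
      (uncurry (by₂ (taut (φ ∷ ψ ∷ []) (p₀ ⟶ p₁ ⟶ p₀ & p₁))))

    mem-imp : ∀ {φ ψ} → mem x (φ ⇒ ψ) ⇔ (mem x φ → mem x ψ)
    mem-imp {φ} {ψ} = mk⇔ mp intro
      where
      intro : (mem x φ → mem x ψ) → mem x (φ ⇒ ψ)
      intro h with maximal x φ
      ... | inj₁ φ∈ = by₁ (taut (φ ∷ ψ ∷ []) (p₁ ⟶ p₀ ⟶ p₁)) (h φ∈)
      ... | inj₂ ¬φ = by₁ (taut (φ ∷ ψ ∷ []) (~ p₀ ⟶ p₀ ⟶ p₁)) ¬φ

    mem-axiom : ∀ {φ ψ} → ⊢ (φ ⇔F ψ) → mem x φ ⇔ mem x ψ
    mem-axiom d = mk⇔ (to mem-imp (proj₁ both)) (to mem-imp (proj₂ both))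
      where both = to mem-and (thm d)

  -- The infinitary rules R5 and R6 share one shape: η(head h) follows from
  -- η(premise h f) for all choices f ∈ L_EL^G.
  data Head : Set where
    group     : Subset n → Formula → Formula → Head
    coalition : Subset n → Formula → Head

  head : Head → Formula
  head (group G χ ψ)   = grp G χ ψ
  head (coalition G ψ) = coal G ψ

  premise : Head → ELG → Formula
  premise (group G χ ψ)   f = and χ (ann (and (embed (⟦ f ⟧ G)) χ) ψ)
  premise (coalition G ψ) f = grpDia (∁ G) (embed (⟦ f ⟧ G)) ψ

  close : ∀ {x} → IsTheory x → ∀ η h → (∀ f → x (plug η (premise h f))) → x (plug η (head h))
  close T η (group G χ ψ)   = IsTheory.r5 T η G χ ψ
  close T η (coalition G ψ) = IsTheory.r6 T η G ψ

  unfold-axiom : ∀ h f → ⊢ (head h ⇒ premise h f)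
  unfold-axiom (group G χ ψ)   f = A10 G χ ψ f
  unfold-axiom (coalition G ψ) f = A11 G ψ f

  -- A formula is η(head h) in at most one way: decompose is a left inverse.
  decompose : Formula → Maybe (NForm × Head)
  decompose (neg (and φ (neg ψ))) = mapMaybe (map₁ (nimp φ)) (decompose ψ)
  decompose (K i ψ)               = mapMaybe (map₁ (nK i)) (decompose ψ)
  decompose (ann φ ψ)             = mapMaybe (map₁ (nann φ)) (decompose ψ)
  decompose (grp G χ ψ)           = just (♯ , group G χ ψ)
  decompose (coal G ψ)            = just (♯ , coalition G ψ)
  decompose _                     = nothing

  decompose-plug : ∀ η h → decompose (plug η (head h)) ≡ just (η , h)
  decompose-plug ♯          (group G χ ψ)   = refl
  decompose-plug ♯          (coalition G ψ) = refl
  decompose-plug (nimp φ η) h = cong (mapMaybe (map₁ (nimp φ))) (decompose-plug η h)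
  decompose-plug (nK i η)   h = cong (mapMaybe (map₁ (nK i))) (decompose-plug η h)
  decompose-plug (nann φ η) h = cong (mapMaybe (map₁ (nann φ))) (decompose-plug η h)

  Decomposition : Formula → Set
  Decomposition φ = Σ (NForm × Head) λ (η , h) → plug η (head h) ≡ φ

  decomposition-unique : ∀ {η h η′ h′} → plug η (head h) ≡ plug η′ (head h′) → (η , h) ≡ (η′ , h′)
  decomposition-unique {η} {h} {η′} {h′} e =
    just-injective (trans (sym (decompose-plug η h)) (trans (cong decompose e) (decompose-plug η′ h′)))

  -- Assuming φ: {ψ | φ → ψ ∈ x} is again a theory; closure under R5/R6 is
  -- inherited through the necessity form φ → ♯.
  assume : ∀ {x} φ → IsTheory x → IsTheory (λ ψ → x (φ ⇒ ψ))
  assume {x} φ T = record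
    { thm = λ {ψ} d → thm (R0 (taut (ψ ∷ φ ∷ []) (p₀ ⟶ p₁ ⟶ p₀)) d)
    ; mp  = λ {ψ} {χ} → by₂ (taut (φ ∷ ψ ∷ χ ∷ []) ((p₀ ⟶ p₁ ⟶ p₂) ⟶ (p₀ ⟶ p₁) ⟶ p₀ ⟶ p₂))
    ; r5  = λ η → r5 (nimp φ η)
    ; r6  = λ η → r6 (nimp φ η) }
    where open TheoryReasoning T

  K-assume : ∀ {x} i φ → IsTheory x → IsTheory (λ ψ → x (K i (φ ⇒ ψ)))
  K-assume {x} i φ T = record
    { thm = λ {ψ} d → thm (R1 i (R0 (taut (ψ ∷ φ ∷ []) (p₀ ⟶ p₁ ⟶ p₀)) d))
    ; mp  = λ {ψ} {χ} → by₂ (K-mono₂ i (taut (φ ∷ ψ ∷ χ ∷ []) ((p₀ ⟶ p₁ ⟶ p₂) ⟶ (p₀ ⟶ p₁) ⟶ p₀ ⟶ p₂)))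
    ; r5  = λ η → r5 (nK i (nimp φ η))
    ; r6  = λ η → r6 (nK i (nimp φ η)) }
    where open TheoryReasoning T

  record CTheory : Set₁ where
    field
      has       : Formula → Set
      theory    : IsTheory has
      noFalsum  : ¬ has ⊥F
  open CTheory

  extend : (x : CTheory) (φ : Formula) → ¬ has x (φ ⇒ ⊥F) → CTheory
  extend x φ c = record { has = λ ψ → has x (φ ⇒ ψ) ; theory = assume φ (theory x) ; noFalsum = c }

  extend-⊇ : ∀ x φ c → has x ⊆ has (extend x φ c)
  extend-⊇ x φ c {ψ} = TheoryReasoning.by₁ (theory x) (taut (ψ ∷ φ ∷ []) (p₀ ⟶ p₁ ⟶ p₀))

  extend-∋ : ∀ x φ c → has (extend x φ c) φ
  extend-∋ x φ c = TheoryReasoning.thm (theory x) (taut (φ ∷ []) (p₀ ⟶ p₀))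

  refuted-consistent : ∀ x φ → has x (φ ⇒ ⊥F) → ¬ has x (neg φ ⇒ ⊥F)
  refuted-consistent x φ refuted ¬φ-refuted = noFalsum x (TheoryReasoning.by₂ (theory x)
    (taut (φ ∷ var 0 ∷ []) ((p₀ ⟶ ⊥ₚ p₁) ⟶ (~ p₀ ⟶ ⊥ₚ p₁) ⟶ ⊥ₚ p₁)) refuted ¬φ-refuted)

  Witnessed : (Formula → Set) → Formula → Set
  Witnessed z φ = ∀ η h → plug η (head h) ≡ φ → Σ ELG λ f → z (neg (plug η (premise h f)))

  -- φ is decided by z, and a rejection of φ is witnessed.  A union of a chain
  -- settling every formula is maximal and closed under R5/R6.
  Settled : (Formula → Set) → Formula → Set
  Settled z φ = z φ ⊎ (z (neg φ) × Witnessed z φ)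

  settled-mono : ∀ {z z′ : Formula → Set} → z ⊆ z′ → ∀ {φ} → Settled z φ → Settled z′ φ
  settled-mono z⊆z′ (inj₁ φ∈) = inj₁ (z⊆z′ φ∈)
  settled-mono z⊆z′ (inj₂ (¬φ∈ , wit)) = inj₂ (z⊆z′ ¬φ∈ , λ η h q → map₂ z⊆z′ (wit η h q))

  subsets : (m : ℕ) → List (Subset m)
  subsets zero        = [] ∷ []
  subsets (Nat.suc m) = Data.List.map (true ∷_) (subsets m) ++ Data.List.map (false ∷_) (subsets m)

  subsets-complete : ∀ {m} (G : Subset m) → G ∈ subsets m
  subsets-complete []          = here refl
  subsets-complete (true ∷ G)  = ∈-++⁺ˡ (∈-map⁺ (true ∷_) (subsets-complete G))
  subsets-complete {Nat.suc m} (false ∷ G) =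
    ∈-++⁺ʳ (Data.List.map (true ∷_) (subsets m)) (∈-map⁺ (false ∷_) (subsets-complete G))

  -- An enumeration of all formulas: formulas k lists every formula of rank
  -- at most k, where rank bounds both the height and the variables used.
  rank : Formula → ℕ
  rank (var p)     = Nat.suc p
  rank (neg φ)     = Nat.suc (rank φ)
  rank (and φ ψ)   = Nat.suc (rank φ ⊔ rank ψ)
  rank (K i φ)     = Nat.suc (rank φ)
  rank (ann φ ψ)   = Nat.suc (rank φ ⊔ rank ψ)
  rank (grp G χ ψ) = Nat.suc (rank χ ⊔ rank ψ)
  rank (coal G φ)  = Nat.suc (rank φ)

  oneLevel : List Formula → List (List Formula)
  oneLevel l =
    Data.List.map neg l ∷
    cartesianProductWith and l l ∷
    cartesianProductWith K (allFin n) l ∷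
    cartesianProductWith ann l l ∷
    cartesianProductWith (λ G → uncurry (grp G)) (subsets n) (cartesianProduct l l) ∷
    cartesianProductWith coal (subsets n) l ∷ []

  formulas : ℕ → List Formula
  formulas zero        = []
  formulas (Nat.suc k) = Data.List.map var (upTo (Nat.suc k)) ++ concat (oneLevel (formulas k))

  in-next : ∀ k {φ vs} → φ ∈ vs → vs ∈ oneLevel (formulas k) → φ ∈ formulas (Nat.suc k)
  in-next k φ∈ vs∈ = ∈-++⁺ʳ (Data.List.map var (upTo (Nat.suc k))) (∈-concat⁺′ φ∈ vs∈)

  formulas-complete : ∀ φ k → rank φ ≤ k → φ ∈ formulas k
  formulas-complete (var p) (Nat.suc k) (s≤s r) = ∈-++⁺ˡ (∈-map⁺ var (∈-upTo⁺ (s≤s r)))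
  formulas-complete (neg φ) (Nat.suc k) (s≤s r) =
    in-next k (∈-map⁺ neg (formulas-complete φ k r)) (here refl)
  formulas-complete (and φ ψ) (Nat.suc k) (s≤s r) =
    in-next k (∈-cartesianProductWith⁺ and (formulas-complete φ k (m⊔n≤o⇒m≤o _ _ r))
                                           (formulas-complete ψ k (m⊔n≤o⇒n≤o _ _ r)))
              (there (here refl))
  formulas-complete (K i φ) (Nat.suc k) (s≤s r) =
    in-next k (∈-cartesianProductWith⁺ K (∈-allFin i) (formulas-complete φ k r))
              (there (there (here refl)))
  formulas-complete (ann φ ψ) (Nat.suc k) (s≤s r) =
    in-next k (∈-cartesianProductWith⁺ ann (formulas-complete φ k (m⊔n≤o⇒m≤o _ _ r))
                                           (formulas-complete ψ k (m⊔n≤o⇒n≤o _ _ r)))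
              (there (there (there (here refl))))
  formulas-complete (grp G χ ψ) (Nat.suc k) (s≤s r) =
    in-next k (∈-cartesianProductWith⁺ (λ G → uncurry (grp G)) (subsets-complete G)
                 (∈-cartesianProduct⁺ (formulas-complete χ k (m⊔n≤o⇒m≤o _ _ r))
                                      (formulas-complete ψ k (m⊔n≤o⇒n≤o _ _ r))))
              (there (there (there (there (here refl)))))
  formulas-complete (coal G φ) (Nat.suc k) (s≤s r) =
    in-next k (∈-cartesianProductWith⁺ coal (subsets-complete G) (formulas-complete φ k r))
              (there (there (there (there (there (here refl))))))

  -- The induction measure.  depth counts nested quantifying operators
  -- [G,χ], [⟨G⟩] (adding up under announcements); size weighs [φ]ψ as
  -- (4 + size φ) · size ψ, so that each reduction axiom decreases it.
  depth : Formula → ℕ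
  depth (var p)     = 0
  depth (neg φ)     = depth φ
  depth (and φ ψ)   = depth φ ⊔ depth ψ
  depth (K i φ)     = depth φ
  depth (ann φ ψ)   = depth φ + depth ψ
  depth (grp G χ ψ) = Nat.suc (depth χ + depth ψ)
  depth (coal G φ)  = Nat.suc (Nat.suc (depth φ))

  size : Formula → ℕ
  size (var p)     = 1
  size (neg φ)     = Nat.suc (size φ)
  size (and φ ψ)   = Nat.suc (size φ ⊔ size ψ)
  size (K i φ)     = Nat.suc (size φ)
  size (ann φ ψ)   = (4 + size φ) * size ψ
  size (grp G χ ψ) = 1
  size (coal G φ)  = 1

  open LexInduction depth size

  depth-embed : ∀ e → depth (embed e) ≡ 0
  depth-embed (evar p)   = refl
  depth-embed (eneg e)   = depth-embed e
  depth-embed (eand e d) = cong₂ _⊔_ (depth-embed e) (depth-embed d)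
  depth-embed (eK i e)   = depth-embed e

  size-positive : ∀ φ → 1 ≤ size φ
  size-positive (var p)     = s≤s z≤n
  size-positive (neg φ)     = s≤s z≤n
  size-positive (and φ ψ)   = s≤s z≤n
  size-positive (K i φ)     = s≤s z≤n
  size-positive (ann φ ψ)   = ≤-trans (size-positive ψ) (m≤m+n (size ψ) _)
  size-positive (grp G χ ψ) = s≤s z≤n
  size-positive (coal G φ)  = s≤s z≤n

  depth-premise : ∀ h f → depth (premise h f) < depth (head h)
  depth-premise (group G χ ψ) f rewrite depth-embed (⟦ f ⟧ G) =
    s≤s (⊔-lub (m≤m+n (depth χ) (depth ψ)) ≤-refl)
  depth-premise (coalition G ψ) f rewrite depth-embed (⟦ f ⟧ G) = n<1+n _

  ≺-premise : ∀ h f → premise h f ≺ head h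
  ≺-premise h f = inj₁ (depth-premise h f)

  ≺-ann-premise : ∀ φ h f → ann φ (premise h f) ≺ ann φ (head h)
  ≺-ann-premise φ h f = inj₁ (+-monoʳ-< (depth φ) (depth-premise h f))

  ≺-neg : ∀ φ → φ ≺ neg φ
  ≺-neg φ = inj₂ (≤-refl , n<1+n (size φ))

  ≺-andˡ : ∀ φ ψ → φ ≺ and φ ψ
  ≺-andˡ φ ψ = inj₂ (m≤m⊔n (depth φ) (depth ψ) , s≤s (m≤m⊔n (size φ) (size ψ)))

  ≺-andʳ : ∀ φ ψ → ψ ≺ and φ ψ
  ≺-andʳ φ ψ = inj₂ (m≤n⊔m (depth φ) (depth ψ) , s≤s (m≤n⊔m (size φ) (size ψ)))

  ≺-K : ∀ i φ → φ ≺ K i φ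
  ≺-K i φ = inj₂ (≤-refl , n<1+n (size φ))

  size-announced : ∀ φ ψ → size φ < size (ann φ ψ)
  size-announced φ ψ = c<[4+c]*k (size φ) (size ψ) (size-positive ψ)
    where
    c<[4+c]*k : ∀ c k → 1 ≤ k → c < (4 + c) * k
    c<[4+c]*k c (Nat.suc k) _ = <-≤-trans (s≤s (m≤n+m c 3)) (m≤m*n (4 + c) (Nat.suc k))

  ≺-announced : ∀ φ ψ → φ ≺ ann φ ψ
  ≺-announced φ ψ = inj₂ (m≤m+n (depth φ) (depth ψ) , size-announced φ ψ)

  ≺-ann-neg : ∀ φ ψ → ann φ ψ ≺ ann φ (neg ψ)
  ≺-ann-neg φ ψ = inj₂ (≤-refl , *-monoʳ-< (4 + size φ) (n<1+n (size ψ)))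

  ≺-ann-andˡ : ∀ φ ψ χ → ann φ ψ ≺ ann φ (and ψ χ)
  ≺-ann-andˡ φ ψ χ = inj₂ ( +-monoʳ-≤ (depth φ) (m≤m⊔n (depth ψ) (depth χ))
                          , *-monoʳ-< (4 + size φ) (s≤s (m≤m⊔n (size ψ) (size χ))))

  ≺-ann-andʳ : ∀ φ ψ χ → ann φ χ ≺ ann φ (and ψ χ)
  ≺-ann-andʳ φ ψ χ = inj₂ ( +-monoʳ-≤ (depth φ) (m≤n⊔m (depth ψ) (depth χ))
                          , *-monoʳ-< (4 + size φ) (s≤s (m≤n⊔m (size ψ) (size χ))))

  -- A8: K_a[φ]ψ is smaller than [φ]K_aψ, since (4 + c)(1 + s) = 4 + c + (4 + c)s
  ≺-ann-K : ∀ φ i ψ → K i (ann φ ψ) ≺ ann φ (K i ψ)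
  ≺-ann-K φ i ψ = inj₂ (≤-refl , ≤-trans (s≤s (s≤s (m≤n+m (c4 * s) (2 + c)))) (≤-reflexive (sym (*-suc c4 s))))
    where
    c = size φ
    s = size ψ
    c4 = 4 + c

  ≺-ann-ann : ∀ φ ψ χ → ann (and φ (ann φ ψ)) χ ≺ ann φ (ann ψ χ)
  ≺-ann-ann φ ψ χ =
    inj₂ ( ≤-trans (+-monoˡ-≤ (depth χ) (⊔-lub (m≤m+n (depth φ) (depth ψ)) ≤-refl))
                   (≤-reflexive (+-assoc (depth φ) (depth ψ) (depth χ)))
         , <-≤-trans (*-monoˡ-< k inner) (≤-reflexive (*-assoc (4 + a) (4 + b) k)))
    where
    a = size φ
    b = size ψ
    k = size χ
    instance
      k-nonZero : Nat.NonZero k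
      k-nonZero = Nat.>-nonZero (size-positive χ)
    a⊔ab≤ab : a ⊔ (4 + a) * b ≤ (4 + a) * b
    a⊔ab≤ab = ⊔-lub (<⇒≤ (size-announced φ ψ)) ≤-refl
    inner : 4 + Nat.suc (a ⊔ (4 + a) * b) < (4 + a) * (4 + b)
    inner = begin-strict
      4 + Nat.suc (a ⊔ (4 + a) * b) ≤⟨ +-monoʳ-≤ 5 a⊔ab≤ab ⟩
      5 + (4 + a) * b               <⟨ +-monoˡ-< ((4 + a) * b) (m≤m+n 6 10) ⟩
      16 + (4 + a) * b              ≤⟨ +-monoˡ-≤ ((4 + a) * b) (*-monoˡ-≤ 4 (m≤m+n 4 a)) ⟩
      (4 + a) * 4 + (4 + a) * b     ≡⟨ sym (*-distribˡ-+ (4 + a) 4 b) ⟩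
      (4 + a) * (4 + b)             ∎
      where open Data.Nat.Properties.≤-Reasoning

  record Bisim {a b c d z} (M : Model a b) (N : Model c d)
               (Z : Model.W M → Model.W N → Set z) : Set (a L.⊔ b L.⊔ c L.⊔ d L.⊔ z) where
    field
      atoms : ∀ {w v} p → Z w v → Model.V M p w ⇔ Model.V N p v
      forth : ∀ {w v} i w′ → Z w v → Model.R M i w w′ → Σ (Model.W N) λ v′ → Model.R N i v v′ × Z w′ v′
      back  : ∀ {w v} i v′ → Z w v → Model.R N i v v′ → Σ (Model.W M) λ w′ → Model.R M i w w′ × Z w′ v′
  open Bisim

  module _ {a b c d z} {M : Model a b} {N : Model c d} {Z : Model.W M → Model.W N → Set z}
           (B : Bisim M N Z) where

    restrict-bisim : ∀ {p q} (P : Model.W M → Set p) (Q : Model.W N → Set q) →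
                     (∀ {w v} → Z w v → P w ⇔ Q v) →
                     Bisim (restrict M P) (restrict N Q) (λ u u′ → Z (proj₁ u) (proj₁ u′))
    restrict-bisim P Q P⇔Q = record
      { atoms = λ p → atoms B p
      ; forth = λ { i (w′ , Pw′) z r → let (v′ , r′ , z′) = forth B i w′ z r in (v′ , to (P⇔Q z′) Pw′) , r′ , z′ }
      ; back  = λ { i (v′ , Qv′) z r → let (w′ , r′ , z′) = back B i v′ z r in (w′ , from (P⇔Q z′) Qv′) , r′ , z′ } }

    box-bisim : ∀ {p q} i {P : Model.W M → Set p} {Q : Model.W N → Set q} →
                (∀ {w v} → Z w v → P w ⇔ Q v) → ∀ {w v} → Z w v →
                (∀ w′ → Model.R M i w w′ → P w′) ⇔ (∀ v′ → Model.R N i v v′ → Q v′)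
    box-bisim i P⇔Q z = mk⇔
      (λ s v′ r → let (w′ , r′ , z′) = back B i v′ z r in to (P⇔Q z′) (s w′ r′))
      (λ s w′ r → let (v′ , r′ , z′) = forth B i w′ z r in from (P⇔Q z′) (s v′ r′))

    satEL-bisim : ∀ e {w v} → Z w v → satEL M w e ⇔ satEL N v e
    satEL-bisim (evar p)   z = lift-⇔ (atoms B p z)
    satEL-bisim (eneg e)   z = ¬-cong-⇔ (satEL-bisim e z)
    satEL-bisim (eand e d) z = satEL-bisim e z ×-⇔ satEL-bisim d z
    satEL-bisim (eK i e)   z = box-bisim i (satEL-bisim e) z

  -- Truth of CoRGAL formulas is invariant under bisimulation.  At an
  -- announcement the proof continues in the restricted models, so the
  -- bisimulation varies along the recursion.
  bisim-invariance : ∀ {a b c d z} {M : Model a b} {N : Model c d} {Z : Model.W M → Model.W N → Set z} →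
                     Bisim M N Z → ∀ φ {w v} → Z w v → M , w ⊨ φ ⇔ N , v ⊨ φ
  bisim-invariance B (var p)     z = lift-⇔ (atoms B p z)
  bisim-invariance B (neg φ)     z = ¬-cong-⇔ (bisim-invariance B φ z)
  bisim-invariance B (and φ ψ)   z = bisim-invariance B φ z ×-⇔ bisim-invariance B ψ z
  bisim-invariance B (K i φ)     z = box-bisim B i (bisim-invariance B φ) z
  bisim-invariance B (ann φ ψ)   z =
    Π-dom-⇔ (bisim-invariance B φ z) λ _ _ →
      bisim-invariance (restrict-bisim B _ _ (bisim-invariance B φ)) ψ z
  bisim-invariance {M = M} {N} {Z} B (grp G χ ψ) z =
    bisim-invariance B χ z ×-⇔ Π-⇔ λ f →
      Π-dom-⇔ (θ⇔ f z) λ _ _ → bisim-invariance (restrict-bisim B _ _ (θ⇔ f)) ψ z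
    where
    θ⇔ : ∀ f {w v} → Z w v → (satEL M w (⟦ f ⟧ G) × M , w ⊨ χ) ⇔ (satEL N v (⟦ f ⟧ G) × N , v ⊨ χ)
    θ⇔ f z′ = satEL-bisim B (⟦ f ⟧ G) z′ ×-⇔ bisim-invariance B χ z′
  bisim-invariance {M = M} {N} {Z} B (coal G ψ) z = Π-⇔ λ f → Σ-⇔ λ g →
    →-cong-⇔ (satEL-bisim B (⟦ f ⟧ G) z) (¬-cong-⇔
      (Π-dom-⇔ (θ⇔ f g z) λ _ _ → ¬-cong-⇔ (bisim-invariance (restrict-bisim B _ _ (θ⇔ f g)) ψ z)))
    where
    θ⇔ : ∀ f g {w v} → Z w v → (satEL M w (⟦ f ⟧ G) × satEL M w (⟦ g ⟧ (∁ G)))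
                             ⇔ (satEL N v (⟦ f ⟧ G) × satEL N v (⟦ g ⟧ (∁ G)))
    θ⇔ f g z′ = satEL-bisim B (⟦ f ⟧ G) z′ ×-⇔ satEL-bisim B (⟦ g ⟧ (∁ G)) z′

  id-bisim : ∀ {a b} (M : Model a b) → Bisim M M _≡_
  id-bisim M = record
    { atoms = λ { p refl → ⇔-id _ }
    ; forth = λ { i w′ refl r → w′ , r , refl }
    ; back  = λ { i v′ refl r → v′ , r , refl } }

  restrict-cong : ∀ {a b p q} (M : Model a b) {P : Model.W M → Set p} {Q : Model.W M → Set q} →
                  (∀ {w} → P w ⇔ Q w) → ∀ ψ {w} (h : P w) (h′ : Q w) →
                  restrict M P , (w , h) ⊨ ψ ⇔ restrict M Q , (w , h′) ⊨ ψ
  restrict-cong M P⇔Q ψ h h′ = bisim-invariance (restrict-bisim (id-bisim M) _ _ λ { refl → P⇔Q }) ψ refl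

  restrict-irrelevant : ∀ {a b p} (M : Model a b) (P : Model.W M → Set p) ψ {w} (h h′ : P w) →
                        restrict M P , (w , h) ⊨ ψ → restrict M P , (w , h′) ⊨ ψ
  restrict-irrelevant M P ψ h h′ = to (restrict-cong M (⇔-id _) ψ h h′)

  announce-cong : ∀ {a b p q} (M : Model a b) {P : Model.W M → Set p} {Q : Model.W M → Set q} →
                  (∀ {w} → P w ⇔ Q w) → ∀ ψ w →
                  ((h : P w) → restrict M P , (w , h) ⊨ ψ) ⇔ ((h : Q w) → restrict M Q , (w , h) ⊨ ψ)
  announce-cong M P⇔Q ψ w = Π-dom-⇔ P⇔Q (restrict-cong M P⇔Q ψ)

  embed-sat : ∀ {a b} (M : Model a b) e {w} → satEL M w e ⇔ M , w ⊨ embed e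
  embed-sat M (evar p)   = ⇔-id _
  embed-sat M (eneg e)   = ¬-cong-⇔ (embed-sat M e)
  embed-sat M (eand e d) = embed-sat M e ×-⇔ embed-sat M d
  embed-sat M (eK i e)   = Π-⇔ λ v → Π-⇔ λ _ → embed-sat M e {v}

  someChoice : ELG
  someChoice _ = ⊤EL

  -- Semantic counterpart of A10/R5 and A11/R6: η(head h) holds iff all its
  -- premises hold (classically, for the coalition operator).
  head-unfold : ∀ {a b} (M : Model a b) → ExcludedMiddle (a L.⊔ b) → ∀ h w →
                M , w ⊨ head h ⇔ (∀ f → M , w ⊨ premise h f)
  head-unfold M em (group G χ ψ) w = mk⇔
    (λ (c , k) f → c , to (after f) (k f))
    (λ k → proj₁ (k someChoice) , λ f → from (after f) (proj₂ (k f)))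
    where after = λ f → announce-cong M (embed-sat M (⟦ f ⟧ G) ×-⇔ ⇔-id _) ψ w
  head-unfold {a} {b} M em (coalition G ψ) w = Π-⇔ λ f → begin
    Σ ELG (λ g → satEL M w (⟦ f ⟧ G) → ¬ ((h : θ f g w) → ¬ restrict M (θ f g) , (w , h) ⊨ ψ))
      ∼⟨ classical-witness em someChoice ⟩
    ¬ (satEL M w (⟦ f ⟧ G) × (∀ g → (h : θ f g w) → ¬ restrict M (θ f g) , (w , h) ⊨ ψ))
      ∼⟨ ¬-cong-⇔ (embed-sat M (⟦ f ⟧ G) ×-⇔ Π-⇔ λ g → announce-cong M (θ⇔θ′ f g) (neg ψ) w) ⟩
    M , w ⊨ premise (coalition G ψ) f ∎
    where
    open EquationalReasoning {k = equivalence}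
    -- the announcement ψ_G ∧ χ_{A∖G} as it appears in [⟨G⟩] and in ⟨A∖G, ψ_G⟩
    θ θ′ : ELG → ELG → Model.W M → Set (a L.⊔ b)
    θ  f g v = satEL M v (⟦ f ⟧ G) × satEL M v (⟦ g ⟧ (∁ G))
    θ′ f g v = satEL M v (⟦ g ⟧ (∁ G)) × M , v ⊨ embed (⟦ f ⟧ G)
    θ⇔θ′ : ∀ f g {v} → θ f g v ⇔ θ′ f g v
    θ⇔θ′ f g = mk⇔ (λ (s , t) → t , to (embed-sat M (⟦ f ⟧ G)) s)
                   (λ (t , e) → from (embed-sat M (⟦ f ⟧ G)) e , t)

  module _ {a b} (M : Model a b) (φ : Formula) {w : Model.W M} where
    private
      Mφ = restrict M (λ v → M , v ⊨ φ)

    ann-var-semantics : ∀ p → (M , w ⊨ φ → M , w ⊨ var p) ⇔ M , w ⊨ ann φ (var p)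
    ann-var-semantics p = Π-⇔ λ _ → lift-⇔ (⇔-id _)

    ann-neg-semantics : ∀ ψ → (M , w ⊨ φ → ¬ M , w ⊨ ann φ ψ) ⇔ M , w ⊨ ann φ (neg ψ)
    ann-neg-semantics ψ = mk⇔
      (λ s h r → s h λ h′ → restrict-irrelevant M _ ψ h h′ r)
      (λ s h r → s h (r h))

    ann-and-semantics : ∀ ψ χ → (M , w ⊨ ann φ ψ × M , w ⊨ ann φ χ) ⇔ M , w ⊨ ann φ (and ψ χ)
    ann-and-semantics ψ χ = mk⇔ (λ (s , t) h → s h , t h) (λ s → proj₁ ∘ s , proj₂ ∘ s)

    ann-K-semantics : ∀ i ψ → (M , w ⊨ φ → M , w ⊨ K i (ann φ ψ)) ⇔ M , w ⊨ ann φ (K i ψ)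
    ann-K-semantics i ψ = mk⇔
      (λ s h (v , h′) r → s h v r h′)
      (λ s h v r h′ → s h (v , h′) r)

    ann-ann-semantics : ∀ ψ χ → M , w ⊨ ann (and φ (ann φ ψ)) χ ⇔ M , w ⊨ ann φ (ann ψ χ)
    ann-ann-semantics ψ χ = mk⇔
      (λ s h h₂ → from (bisim-invariance nested χ refl) (s (h , λ h′ → restrict-irrelevant M _ ψ h h′ h₂)))
      (λ s (h , k) → to (bisim-invariance nested χ refl) (s h (k h)))
      where
      -- announcing φ and then ψ is announcing φ ∧ [φ]ψ once
      nested : Bisim (restrict Mφ (λ u → Mφ , u ⊨ ψ)) (restrict M (λ v → M , v ⊨ and φ (ann φ ψ)))
                     (λ u v → proj₁ (proj₁ u) ≡ proj₁ v)
      nested = record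
        { atoms = λ { p refl → ⇔-id _ }
        ; forth = λ { i ((v , h) , h₂) refl r →
                        (v , h , λ h′ → restrict-irrelevant M _ ψ h h′ h₂) , r , refl }
        ; back  = λ { i (v , h , k) refl r → ((v , h) , k h) , r , refl } }

    ann-head-semantics : ExcludedMiddle (a L.⊔ b) → ∀ h →
                         M , w ⊨ ann φ (head h) ⇔ (∀ f → M , w ⊨ ann φ (premise h f))
    ann-head-semantics em h = mk⇔
      (λ s f hφ → to (head-unfold Mφ em h (w , hφ)) (s hφ) f)
      (λ s hφ → from (head-unfold Mφ em h (w , hφ)) λ f → s f hφ)

  module _ (em : ExcludedMiddle (suc 0ℓ)) where

    decide : (A : Set) → Dec A
    decide A with em {L.Lift (suc 0ℓ) A}
    ... | yes (L.lift a) = yes a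
    ... | no ¬a = no (¬a ∘ L.lift)

    -- The witness exists since y is closed under R5/R6 and does not contain φ.
    witness-rejection : (y : CTheory) (φ : Formula) → has y (neg φ) →
                        Σ CTheory λ z → has y ⊆ has z × Witnessed (has z) φ
    witness-rejection y φ ¬φ∈y with decide (Decomposition φ)
    ... | no none = y , (λ p → p) , λ η h q → ⊥-elim (none ((η , h) , q))
    ... | yes ((η , h) , q) =
      let (f , c) = counter-witness
          π = neg (plug η (premise h f))
      in extend y π c , extend-⊇ y π c , λ η′ h′ q′ →
           f , subst (λ (η , h) → has (extend y π c) (neg (plug η (premise h f))))
                     (decomposition-unique {η} {h} {η′} {h′} (trans q (sym q′))) (extend-∋ y π c)
      where
      open TheoryReasoning (theory y)
      -- if y refuted every ¬η(premise h f), R5/R6 would put φ into y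
      counter-witness : Σ ELG λ f → ¬ has y (neg (plug η (premise h f)) ⇒ ⊥F)
      counter-witness = decidable-stable (decide _) λ none →
        noFalsum y (explode (subst (has y) q (close (theory y) η h λ f →
          by₁ (taut (plug η (premise h f) ∷ var 0 ∷ []) ((~ p₀ ⟶ ⊥ₚ p₁) ⟶ p₀))
              (decidable-stable (decide _) λ c → none (f , c)))) ¬φ∈y)

    reject : (x : CTheory) (φ : Formula) (c : ¬ has x (neg φ ⇒ ⊥F)) →
             Σ CTheory λ z → has x ⊆ has z × Settled (has z) φ
    reject x φ c with witness-rejection (extend x (neg φ) c) φ (extend-∋ x (neg φ) c)
    ... | z , y⊆z , wit = z , (λ p → y⊆z (extend-⊇ x (neg φ) c p)) , inj₂ (y⊆z (extend-∋ x (neg φ) c) , wit)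

    settle : (x : CTheory) (φ : Formula) → Σ CTheory λ z → has x ⊆ has z × Settled (has z) φ
    settle x φ with decide (has x (φ ⇒ ⊥F))
    ... | no  c       = extend x φ c , extend-⊇ x φ c , inj₁ (extend-∋ x φ c)
    ... | yes refuted = reject x φ (refuted-consistent x φ refuted)

    settle-all : (x : CTheory) (l : List Formula) → Σ CTheory λ z → has x ⊆ has z × All (Settled (has z)) l
    settle-all x [] = x , (λ p → p) , []
    settle-all x (φ ∷ l) with settle x φ
    ... | y , x⊆y , φ-settled with settle-all y l
    ...   | z , y⊆z , l-settled = z , (λ p → y⊆z (x⊆y p)) , settled-mono {has y} {has z} y⊆z φ-settled ∷ l-settled

    -- Stage k + 1 of the chain over x₀ settles every
    -- formula of rank at most k; the union of the chain is maximal,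
    -- consistent, and closed under R5/R6 thanks to the witnesses.
    module Chain (x₀ : CTheory) where
      stage : ℕ → CTheory
      stage zero        = x₀
      stage (Nat.suc k) = proj₁ (settle-all (stage k) (formulas k))

      stage-mono : ∀ k d → has (stage k) ⊆ has (stage (d + k))
      stage-mono k zero        p = p
      stage-mono k (Nat.suc d) p = proj₁ (proj₂ (settle-all (stage (d + k)) (formulas (d + k)))) (stage-mono k d p)

      Limit : Formula → Set
      Limit φ = Σ ℕ λ k → has (stage k) φ

      together : ∀ {φ ψ} → Limit φ → Limit ψ → Σ ℕ λ k → has (stage k) φ × has (stage k) ψ
      together {ψ = ψ} (i , p) (j , q) =
        j + i , stage-mono i j p , subst (λ k → has (stage k) ψ) (+-comm i j) (stage-mono j i q)

      settled : ∀ φ → Σ ℕ λ k → Settled (has (stage k)) φ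
      settled φ = Nat.suc (rank φ) ,
        All-lookup (proj₂ (proj₂ (settle-all (stage (rank φ)) (formulas (rank φ)))))
                   (formulas-complete φ (rank φ) ≤-refl)

      limit-noncontradictory : ∀ {φ} → Limit φ → Limit (neg φ) → ⊥
      limit-noncontradictory p ¬p =
        let (k , p′ , ¬p′) = together p ¬p in noFalsum (stage k) (TheoryReasoning.explode (theory (stage k)) p′ ¬p′)

      limit-maximal : ∀ φ → Limit φ ⊎ Limit (neg φ)
      limit-maximal φ with settled φ
      ... | k , inj₁ p        = inj₁ (k , p)
      ... | k , inj₂ (¬p , _) = inj₂ (k , ¬p)

      -- a rejected η(head h) comes with a rejected premise
      limit-closed : ∀ η h → (∀ f → Limit (plug η (premise h f))) → Limit (plug η (head h))
      limit-closed η h premises with settled (plug η (head h))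
      ... | k , inj₁ p = k , p
      ... | k , inj₂ (_ , wit) = let (f , ¬π) = wit η h refl in ⊥-elim (limit-noncontradictory (premises f) (k , ¬π))

      limit : MCT
      limit = record
        { mem        = Limit
        ; isTheory   = record
          { thm = λ d → 0 , TheoryReasoning.thm (theory x₀) d
          ; mp  = λ p q → let (k , p′ , q′) = together p q in k , TheoryReasoning.mp (theory (stage k)) p′ q′
          ; r5  = λ η G χ ψ → limit-closed η (group G χ ψ)
          ; r6  = λ η G ψ → limit-closed η (coalition G ψ) }
        ; consistent = λ (k , p) → noFalsum (stage k) p
        ; maximal    = limit-maximal }

    lindenbaum : (x₀ : CTheory) → Σ MCT λ y → has x₀ ⊆ mem y
    lindenbaum x₀ = Chain.limit x₀ , λ p → 0 , p

    K-witness : ∀ (x : MCT) i φ → ¬ mem x (K i φ) → Σ MCT λ y → x ∼C[ i ] y × mem y (neg φ)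
    K-witness x i φ K∉x = y , x∼y , x₀⊆y (thm (R1 i (taut (φ ∷ []) (~ p₀ ⟶ ~ p₀))))
      where
      open MCTReasoning x
      x₀ : CTheory
      x₀ = record
        { has      = λ ψ → mem x (K i (neg φ ⇒ ψ))
        ; theory   = K-assume i (neg φ) (isTheory x)
        ; noFalsum = K∉x ∘ by₁ (K-mono i (taut (φ ∷ var 0 ∷ []) ((~ p₀ ⟶ ⊥ₚ p₁) ⟶ p₀))) }
      y : MCT
      y = proj₁ (lindenbaum x₀)
      x₀⊆y : has x₀ ⊆ mem y
      x₀⊆y = proj₂ (lindenbaum x₀)
      K-elim : ∀ ψ → mem x (K i ψ) → mem y ψ
      K-elim ψ = x₀⊆y ∘ by₁ (K-mono i (taut (ψ ∷ neg φ ∷ []) (p₀ ⟶ p₁ ⟶ p₀)))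
      -- positive (A3) and negative (A4) introspection make K_a x = K_a y
      x∼y : x ∼C[ i ] y
      x∼y ψ = K-elim (K i ψ) ∘ by₁ (A3 i ψ) , K-back
        where
        K-back : mem y (K i ψ) → mem x (K i ψ)
        K-back Kψ∈y with maximal x (K i ψ)
        ... | inj₁ Kψ∈x = Kψ∈x
        ... | inj₂ ¬Kψ∈x =
          ⊥-elim (to (MCTReasoning.mem-neg y) (K-elim (neg (K i ψ)) (by₁ (A4 i ψ) ¬Kψ∈x)) Kψ∈y)

    Truth : Formula → Set₁
    Truth φ = ∀ x → mem x φ ⇔ canonical , x ⊨ φ

    open EquationalReasoning {k = equivalence}

    truth-var : ∀ p → Truth (var p)
    truth-var p x = mk⇔ L.lift L.lower

    truth-neg : ∀ φ → Truth φ → Truth (neg φ)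
    truth-neg φ IH x = begin
      mem x (neg φ)         ∼⟨ mem-neg ⟩
      (¬ mem x φ)           ∼⟨ ¬-cong-⇔ (IH x) ⟩
      (¬ canonical , x ⊨ φ) ∎
      where open MCTReasoning x

    truth-and : ∀ φ ψ → Truth φ → Truth ψ → Truth (and φ ψ)
    truth-and φ ψ IHφ IHψ x = begin
      mem x (and φ ψ)         ∼⟨ mem-and ⟩
      (mem x φ × mem x ψ)     ∼⟨ IHφ x ×-⇔ IHψ x ⟩
      canonical , x ⊨ and φ ψ ∎
      where open MCTReasoning x

    -- K_a: truth lemma for φ in all ∼_a-successors, plus the existence lemma
    truth-K : ∀ i φ → Truth φ → Truth (K i φ)
    truth-K i φ IH x = mk⇔ (λ Kφ∈x v x∼v → to (IH v) (MCTReasoning.by₁ v (A2 i φ) (proj₁ (x∼v φ) Kφ∈x))) known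
      where
      known : canonical , x ⊨ K i φ → mem x (K i φ)
      known Kφ with maximal x (K i φ)
      ... | inj₁ Kφ∈x = Kφ∈x
      ... | inj₂ ¬Kφ∈x =
        let (y , x∼y , ¬φ∈y) = K-witness x i φ (to (MCTReasoning.mem-neg x) ¬Kφ∈x)
        in ⊥-elim (to (MCTReasoning.mem-neg y) ¬φ∈y (from (IH y) (Kφ y x∼y)))

    -- [G,χ] and [⟨G⟩]: A10/A11 one way, R5/R6 (with η = ♯) the other
    truth-head : ∀ h → (∀ f → Truth (premise h f)) → Truth (head h)
    truth-head h IH x = mk⇔
      (λ m → from (head-unfold canonical em h x) λ f → to (IH f x) (by₁ (unfold-axiom h f) m))
      (λ s → close (isTheory x) ♯ h λ f → from (IH f x) (to (head-unfold canonical em h x) s f))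
      where open MCTReasoning x

    truth-ann-var : ∀ φ p → Truth φ → Truth (ann φ (var p))
    truth-ann-var φ p IHφ x = begin
      mem x (ann φ (var p))                                 ∼⟨ mem-axiom (A5 φ p) ⟩
      mem x (φ ⇒ var p)                                     ∼⟨ mem-imp ⟩
      (mem x φ → mem x (var p))                             ∼⟨ →-cong-⇔ (IHφ x) (truth-var p x) ⟩
      (canonical , x ⊨ φ → canonical , x ⊨ var p)           ∼⟨ ann-var-semantics canonical φ p ⟩
      canonical , x ⊨ ann φ (var p)                         ∎
      where open MCTReasoning x

    truth-ann-neg : ∀ φ ψ → Truth φ → Truth (ann φ ψ) → Truth (ann φ (neg ψ))
    truth-ann-neg φ ψ IHφ IHφψ x = begin
      mem x (ann φ (neg ψ))                                 ∼⟨ mem-axiom (A6 φ ψ) ⟩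
      mem x (φ ⇒ neg (ann φ ψ))                             ∼⟨ mem-imp ⟩
      (mem x φ → mem x (neg (ann φ ψ)))                     ∼⟨ →-cong-⇔ (IHφ x) (truth-neg _ IHφψ x) ⟩
      (canonical , x ⊨ φ → ¬ canonical , x ⊨ ann φ ψ)       ∼⟨ ann-neg-semantics canonical φ ψ ⟩
      canonical , x ⊨ ann φ (neg ψ)                         ∎
      where open MCTReasoning x

    truth-ann-and : ∀ φ ψ χ → Truth (ann φ ψ) → Truth (ann φ χ) → Truth (ann φ (and ψ χ))
    truth-ann-and φ ψ χ IHψ IHχ x = begin
      mem x (ann φ (and ψ χ))                               ∼⟨ mem-axiom (A7 φ ψ χ) ⟩
      mem x (and (ann φ ψ) (ann φ χ))                       ∼⟨ mem-and ⟩
      (mem x (ann φ ψ) × mem x (ann φ χ))                   ∼⟨ IHψ x ×-⇔ IHχ x ⟩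
      (canonical , x ⊨ ann φ ψ × canonical , x ⊨ ann φ χ)   ∼⟨ ann-and-semantics canonical φ ψ χ ⟩
      canonical , x ⊨ ann φ (and ψ χ)                       ∎
      where open MCTReasoning x

    truth-ann-K : ∀ φ i ψ → Truth φ → Truth (K i (ann φ ψ)) → Truth (ann φ (K i ψ))
    truth-ann-K φ i ψ IHφ IHK x = begin
      mem x (ann φ (K i ψ))                                 ∼⟨ mem-axiom (A8 φ i ψ) ⟩
      mem x (φ ⇒ K i (ann φ ψ))                             ∼⟨ mem-imp ⟩
      (mem x φ → mem x (K i (ann φ ψ)))                     ∼⟨ →-cong-⇔ (IHφ x) (IHK x) ⟩
      (canonical , x ⊨ φ → canonical , x ⊨ K i (ann φ ψ))   ∼⟨ ann-K-semantics canonical φ i ψ ⟩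
      canonical , x ⊨ ann φ (K i ψ)                         ∎
      where open MCTReasoning x

    truth-ann-ann : ∀ φ ψ χ → Truth (ann (and φ (ann φ ψ)) χ) → Truth (ann φ (ann ψ χ))
    truth-ann-ann φ ψ χ IH x = begin
      mem x (ann φ (ann ψ χ))                               ∼⟨ mem-axiom (A9 φ ψ χ) ⟩
      mem x (ann (and φ (ann φ ψ)) χ)                       ∼⟨ IH x ⟩
      canonical , x ⊨ ann (and φ (ann φ ψ)) χ               ∼⟨ ann-ann-semantics canonical φ ψ χ ⟩
      canonical , x ⊨ ann φ (ann ψ χ)                       ∎
      where open MCTReasoning x

    -- [φ][G,χ] and [φ][⟨G⟩]: as truth-head, in the necessity form [φ]♯
    truth-ann-head : ∀ φ h → (∀ f → Truth (ann φ (premise h f))) → Truth (ann φ (head h))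
    truth-ann-head φ h IH x = mk⇔
      (λ m → from (ann-head-semantics canonical φ em h) λ f → to (IH f x) (by₁ (ann-mono φ (unfold-axiom h f)) m))
      (λ s → close (isTheory x) (nann φ ♯) h λ f → from (IH f x) (to (ann-head-semantics canonical φ em h) s f))
      where open MCTReasoning x

    truth-step : ∀ φ → (∀ ψ → ψ ≺ φ → Truth ψ) → Truth φ
    truth-step (var p)            ih = truth-var p
    truth-step (neg φ)            ih = truth-neg φ (ih φ (≺-neg φ))
    truth-step (and φ ψ)          ih = truth-and φ ψ (ih φ (≺-andˡ φ ψ)) (ih ψ (≺-andʳ φ ψ))
    truth-step (K i φ)            ih = truth-K i φ (ih φ (≺-K i φ))
    truth-step (grp G χ ψ)        ih = truth-head (group G χ ψ) λ f → ih _ (≺-premise (group G χ ψ) f)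
    truth-step (coal G ψ)         ih = truth-head (coalition G ψ) λ f → ih _ (≺-premise (coalition G ψ) f)
    truth-step (ann φ (var p))    ih = truth-ann-var φ p (ih φ (≺-announced φ (var p)))
    truth-step (ann φ (neg ψ))    ih = truth-ann-neg φ ψ (ih φ (≺-announced φ (neg ψ))) (ih _ (≺-ann-neg φ ψ))
    truth-step (ann φ (and ψ χ))  ih = truth-ann-and φ ψ χ (ih _ (≺-ann-andˡ φ ψ χ)) (ih _ (≺-ann-andʳ φ ψ χ))
    truth-step (ann φ (K i ψ))    ih = truth-ann-K φ i ψ (ih φ (≺-announced φ (K i ψ))) (ih _ (≺-ann-K φ i ψ))
    truth-step (ann φ (ann ψ χ))  ih = truth-ann-ann φ ψ χ (ih _ (≺-ann-ann φ ψ χ))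
    truth-step (ann φ (grp G χ ψ)) ih =
      truth-ann-head φ (group G χ ψ) λ f → ih _ (≺-ann-premise φ (group G χ ψ) f)
    truth-step (ann φ (coal G ψ)) ih =
      truth-ann-head φ (coalition G ψ) λ f → ih _ (≺-ann-premise φ (coalition G ψ) f)

    truth-lemma : ∀ φ → Truth φ
    truth-lemma = induction Truth truth-step

proposition12 : ExcludedMiddle (suc 0ℓ) → (n : ℕ) (φ : CoRGAL.Formula n) (x : CoRGAL.MCT n) →
                  CoRGAL.mem x φ ⇔ CoRGAL._,_⊨_ n (CoRGAL.canonical n) x φ
proposition12 em n = truth-lemma n em
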